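{- Let $n\ge 30$ and let $\pi=(d_1,\ldots,d_n)$ be a graphic sequence with $d_2\ge 6$, $d_3\ge 5$, $d_6\ge 4$ and $d_n\ge 3$. If the sequence $\pi_7$ (defined below) is graphic, then $\pi$ has a realization containing $G(7)$.
   Context: A non-increasing sequence $\pi=(d_1,\ldots,d_n)$ of nonnegative integers is graphic if it is the degree sequence of a simple graph on $n$ vertices (a realization). $G(7)$ is the graph obtained from $K_4$ on vertices $v_1,v_2,v_3,v_4$ by adding new vertices $x_1,x_2,x_3$, joining $x_i$ to $v_1,\ldots,v_{i+1}$ for $1\le i\le 3$, and joining $x_1$ to $x_2$. The sequences $\pi_0,\ldots,\pi_7$ are defined as follows. Let $\pi_0=(d_1,\ldots,d_5,d_6-1,d_7-1,d_8,\ldots,d_n)$. The sequence $\pi_1=(d_2^{(1)},\ldots,d_n^{(1)})$ is obtained from $\pi_0$ by deleting $d_1$, decreasing the first $d_1$ remaining nonzero terms each by one, and then reordering the last $n-7$ terms (those in positions $8,\ldots,n$) to be non-increasing. For $2\le i\le 7$, $i\ne 6$, the sequence $\pi_i=(d_{i+1}^{(i)},\ldots,d_n^{(i)})$ is obtained from $\pi_{i-1}=(d_i^{(i-1)},\ldots,d_n^{(i-1)})$ by deleting $d_i^{(i-1)}$, decreasing the first $d_i^{(i-1)}$ remaining nonzero terms each by one, and reordering the last $n-7$ terms to be non-increasing. The sequence $\pi_6=(d_7^{(6)},\ldots,d_n^{(6)})$ is obtained from $\pi_5=(d_6^{(5)},\ldots,d_n^{(5)})$ by deleting $d_6^{(5)}$,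 decreasing the first $d_6^{(5)}$ remaining nonzero terms each by one except that the term $d_7^{(5)}$ is skipped (not decreased and not counted), and reordering the last $n-7$ terms to be non-increasing. -}

module Defs where

open import Data.Nat using (ℕ; zero; suc; _≤_; _∸_)
open import Data.Nat.Properties using (≤-decTotalOrder)
open import Data.Bool using (Bool; true; false; if_then_else_)
open import Data.Fin using (Fin) renaming (_≤_ to _≤ᶠ_)
open import Data.Nat.ListAction using (sum)
open import Data.List using (List; []; _∷_; map; allFin; take; drop; _++_; length)
open import Data.Vec using (Vec; lookup; fromList) renaming ([] to []ᵛ; _∷_ to _∷ᵛ_)
open import Data.Maybe using (Maybe; just; nothing; _>>=_) renaming (map to mapᵐ)
open import Data.Product using (Σ; ∃; _×_; _,_)
open import Data.List.Relation.Unary.All using (All)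
open import Function.Definitions using (Injective)
open import Relation.Binary.PropositionalEquality using (_≡_)
import Relation.Binary.Properties.DecTotalOrder as DTO
open import Data.List.Sort (DTO.≥-decTotalOrder ≤-decTotalOrder) using (sort)

record SimpleGraph (n : ℕ) : Set where
  field
    adj    : Fin n → Fin n → Bool
    sym    : ∀ i j → adj i j ≡ adj j i
    irrefl : ∀ i → adj i i ≡ false
open SimpleGraph public

degree : ∀ {n} → SimpleGraph n → Fin n → ℕ
degree {n} G i = sum (map (λ j → if adj G i j then 1 else 0) (allFin n))

NonIncreasing : ∀ {n} → Vec ℕ n → Set
NonIncreasing {n} d = ∀ (i j : Fin n) → i ≤ᶠ j → lookup d j ≤ lookup d i

IsRealization : ∀ {n} → Vec ℕ n → SimpleGraph n → Set
IsRealization {n} d G = ∀ (i : Fin n) → degree G i ≡ lookup d i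

Graphic : ∀ {n} → Vec ℕ n → Set
Graphic {n} d = NonIncreasing d × Σ (SimpleGraph n) (IsRealization d)

-- 1-indexed entry d_k of a sequence (0 when out of range; only used in range)
entry : ∀ {n} → Vec ℕ n → ℕ → ℕ
entry []ᵛ _ = 0
entry (x ∷ᵛ xs) zero = 0
entry (x ∷ᵛ xs) (suc zero) = x
entry (x ∷ᵛ xs) (suc (suc k)) = entry xs (suc k)

v₁ v₂ v₃ v₄ x₁ x₂ x₃ : Fin 7
v₁ = Fin.zero
v₂ = Fin.suc Fin.zero
v₃ = Fin.suc (Fin.suc Fin.zero)
v₄ = Fin.suc (Fin.suc (Fin.suc Fin.zero))
x₁ = Fin.suc (Fin.suc (Fin.suc (Fin.suc Fin.zero)))
x₂ = Fin.suc (Fin.suc (Fin.suc (Fin.suc (Fin.suc Fin.zero))))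
x₃ = Fin.suc (Fin.suc (Fin.suc (Fin.suc (Fin.suc (Fin.suc Fin.zero)))))

G7-edges : List (Fin 7 × Fin 7)
G7-edges =
  (v₁ , v₂) ∷ (v₁ , v₃) ∷ (v₁ , v₄) ∷ (v₂ , v₃) ∷ (v₂ , v₄) ∷ (v₃ , v₄) ∷
  (x₁ , v₁) ∷ (x₁ , v₂) ∷
  (x₂ , v₁) ∷ (x₂ , v₂) ∷ (x₂ , v₃) ∷
  (x₃ , v₁) ∷ (x₃ , v₂) ∷ (x₃ , v₃) ∷ (x₃ , v₄) ∷
  (x₁ , x₂) ∷ []

ContainsG7 : ∀ {n} → SimpleGraph n → Set
ContainsG7 {n} G =
  Σ (Fin 7 → Fin n) λ f → Injective _≡_ _≡_ f ×
    All (λ { (a , b) → adj G (f a) (f b) ≡ true }) G7-edges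

-- The sequences π₀, …, π₇ (on lists; nothing = procedure cannot be carried out)

decNZ : ℕ → List ℕ → Maybe (List ℕ)
decNZ zero xs = just xs
decNZ (suc k) [] = nothing
decNZ (suc k) (zero ∷ xs) = mapᵐ (zero ∷_) (decNZ (suc k) xs)
decNZ (suc k) (suc x ∷ xs) = mapᵐ (x ∷_) (decNZ k xs)

sortTail : ℕ → List ℕ → List ℕ
sortTail f xs = take f xs ++ sort (drop f xs)

-- step i (1 ≤ i ≤ 7, i ≠ 6): from π_{i-1} = (d_i, …, d_n) produce π_i.
-- The remaining list has 7 ∸ i terms in positions i+1..7, then positions 8..n.
step : ℕ → List ℕ → Maybe (List ℕ)
step i [] = nothing
step i (x ∷ rest) = mapᵐ (sortTail (7 ∸ i)) (decNZ x rest)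

-- step 6: the term d_7^(5) is skipped
step6 : List ℕ → Maybe (List ℕ)
step6 [] = nothing
step6 (x ∷ []) = nothing
step6 (x ∷ y ∷ rest) = mapᵐ (λ r → y ∷ sort r) (decNZ x rest)

π₀ : List ℕ → List ℕ
π₀ (a ∷ b ∷ c ∷ d ∷ e ∷ f ∷ g ∷ rest) = a ∷ b ∷ c ∷ d ∷ e ∷ (f ∸ 1) ∷ (g ∸ 1) ∷ rest
π₀ xs = xs

π₇ : List ℕ → Maybe (List ℕ)
π₇ d =
  step 1 (π₀ d) >>= step 2 >>= step 3 >>= step 4 >>= step 5 >>= step6 >>= step 7

module Submission where

-- Proof idea (reverse Havel–Hakimi).  π₇ arises from π by the modification π ↦ π₀ and
-- seven laying-off steps; step i deletes the head x and decreases x further terms by one,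
-- then reorders a tail.  Each step can be undone on realizations: relabel the vertices to
-- undo the reordering (which fixes the leading positions), then add a new first vertex
-- joined exactly to the decreased terms.  Undoing steps 7, …, 1 turns the given
-- realization of π₇ into one of π₀.  The degree bounds make the leading terms positive
-- when steps 1–4 are performed, so the vertex at position c is joined to the next 6, 5,
-- 3, 1 positions for c = 0, 1, 2, 3; step 6 skipped d₇, so positions 5 and 6 are not
-- adjacent.  Adding that edge gives a realization of π carrying G(7) on its first seven
-- vertices (v₁, …, v₄ at positions 0–3 and x₃, x₂, x₁ at positions 4, 5, 6).

open import Defs hiding (sym)
open import Relation.Binary.PropositionalEquality
  using (_≡_; _≢_; refl; sym; trans; cong; cong₂; subst; subst₂; setoid; module ≡-Reasoning)
open import Data.Nat using (ℕ; zero; suc; _+_; _∸_; _≤_; _<_; _≤ᵇ_; s≤s)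
open import Data.Nat.Properties
  using (≤-trans; ≤-<-trans; +-suc; +-monoʳ-<; m≤m+n; ≤ᵇ⇒≤; suc-injective; m≤n⇒∃[o]m+o≡n;
         +-0-commutativeMonoid; ≤-decTotalOrder)
open import Data.Bool using (Bool; true; false; if_then_else_; _∧_; _∨_; T)
open import Data.Bool.Properties using (∨-comm; ∧-comm; ∨-zeroʳ; ∨-identityʳ; ∨-idem)
open import Data.Fin using (Fin; toℕ; cast; inject≤; fromℕ; #_) renaming (zero to fz; suc to fs)
open import Data.Fin.Properties
  using (_≟_; toℕ-injective; toℕ-cast; toℕ<n; toℕ-inject≤; inject≤-injective; cast-is-id)
open import Data.Fin.Permutation using (Permutation; _⟨$⟩ʳ_; lift₀; cast-id)
open import Data.Vec.Functional using () renaming (_∷_ to _∷ᶠ_)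
open import Data.List using (List; []; _∷_; length; lookup; tabulate)
open import Data.List.Properties using (map-tabulate)
open import Data.Nat.ListAction using (sum)
open import Data.List.Relation.Unary.All using (All; []; _∷_) renaming (map to mapAll)
open import Data.List.Relation.Binary.Permutation.Propositional using (_↭_; ↭-sym; ↭⇒↭ₛ)
open import Data.List.Relation.Binary.Permutation.Setoid (setoid ℕ) using (onIndices)
open import Data.List.Relation.Binary.Permutation.Setoid.Properties (setoid ℕ) using (onIndices-lookup)
import Relation.Binary.Properties.DecTotalOrder as DTO
open import Data.List.Sort (DTO.≥-decTotalOrder ≤-decTotalOrder) using (sort; sort-↭)
open import Data.Vec using (Vec; toList; fromList) renaming (lookup to lookupᵛ; [] to []ᵛ; _∷_ to _∷ᵛ_)
open import Data.Vec.Properties using (length-toList)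
open import Data.Maybe using (Maybe; just; nothing; _>>=_) renaming (map to mapᵐ)
open import Data.Product using (Σ; ∃; _×_; _,_)
open import Data.Unit using (⊤)
open import Data.Empty using (⊥)
open import Function using (_∘_)
open import Function.Definitions using (Injective)
open import Relation.Nullary using (yes; no; does)
open import Relation.Nullary.Decidable using (dec-true; dec-false)
import Algebra.Properties.CommutativeMonoid.Sum as CommutativeMonoidSum

open ≡-Reasoning
module Σℕ = CommutativeMonoidSum +-0-commutativeMonoid

≤-numerals : ∀ {m n} {_ : T (m ≤ᵇ n)} → m ≤ n
≤-numerals {m} {n} {m≤ᵇn} = ≤ᵇ⇒≤ m n m≤ᵇn

map-just : ∀ {A B : Set} (f : A → B) (m : Maybe A) {y} →
  mapᵐ f m ≡ just y → ∃ λ x → m ≡ just x × f x ≡ y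
map-just f (just x) refl = x , refl , refl

bind-just : ∀ {A B : Set} {m : Maybe A} (g : A → Maybe B) {y} →
  (m >>= g) ≡ just y → ∃ λ x → m ≡ just x × g x ≡ just y
bind-just {m = just x} g eq = x , refl , eq

ind : Bool → ℕ
ind b = if b then 1 else 0

count : ∀ {m} → (Fin m → Bool) → ℕ
count p = Σℕ.sum (λ j → ind (p j))

count-cong : ∀ {m} {p q : Fin m → Bool} → (∀ j → p j ≡ q j) → count p ≡ count q
count-cong p≗q = Σℕ.sum-cong-≗ (λ j → cong ind (p≗q j))

count-none : ∀ m → count {m} (λ _ → false) ≡ 0
count-none zero = refl
count-none (suc m) = count-none m

count-permute : ∀ {m n} (π : Permutation m n) (p : Fin n → Bool) → count (λ j → p (π ⟨$⟩ʳ j)) ≡ count p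
count-permute π p = sym (Σℕ.sum-permute (λ j → ind (p j)) π)

count-insert : ∀ {m} (v : Fin m) (p : Fin m → Bool) → p v ≡ false →
  count (λ j → does (j ≟ v) ∨ p j) ≡ suc (count p)
count-insert {suc m} fz p pv = cong (λ b → suc (ind b + count {m} (λ j → p (fs j)))) (sym pv)
count-insert {suc m} (fs v) p pv =
  trans (cong (ind (p fz) +_) (count-insert v (λ j → p (fs j)) pv)) (+-suc (ind (p fz)) (count {m} (λ j → p (fs j))))

sum-tabulate : ∀ n (f : Fin n → ℕ) → sum (tabulate f) ≡ Σℕ.sum f
sum-tabulate zero f = refl
sum-tabulate (suc n) f = cong (f fz +_) (sum-tabulate n (f ∘ fs))

degree-count : ∀ {n} (G : SimpleGraph n) i → degree G i ≡ count (adj G i)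
degree-count {n} G i = trans (cong sum (map-tabulate (λ j → j) (λ j → ind (adj G i j)))) (sum-tabulate n _)

degree-row : ∀ {n} (G : SimpleGraph n) {i q} → (∀ j → adj G i j ≡ q j) → degree G i ≡ count q
degree-row G {i} row = trans (degree-count G i) (count-cong row)

Realizes : ∀ {n} → SimpleGraph n → (Fin n → ℕ) → Set
Realizes G deg = ∀ i → degree G i ≡ deg i

relabel : ∀ {m n} → SimpleGraph n → (Fin m → Fin n) → SimpleGraph m
relabel H σ = record
  { adj = λ i j → adj H (σ i) (σ j)
  ; sym = λ i j → SimpleGraph.sym H (σ i) (σ j)
  ; irrefl = λ i → irrefl H (σ i) }

degree-relabel : ∀ {m n} (H : SimpleGraph n) (π : Permutation m n) i →
  degree (relabel H (π ⟨$⟩ʳ_)) i ≡ degree H (π ⟨$⟩ʳ i)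
degree-relabel H π i = begin
  degree (relabel H σ) i              ≡⟨ degree-count (relabel H σ) i ⟩
  count (λ j → adj H (σ i) (σ j))     ≡⟨ count-permute π (adj H (σ i)) ⟩
  count (adj H (σ i))                 ≡⟨ sym (degree-count H (σ i)) ⟩
  degree H (σ i)                      ∎
  where σ = π ⟨$⟩ʳ_

realizes-cast : ∀ {m n} (H : SimpleGraph n) {deg} (e : m ≡ n) → Realizes H deg →
  Realizes (relabel H (cast e)) (λ i → deg (cast e i))
realizes-cast H e realizes i = trans (degree-relabel H (cast-id e) i) (realizes (cast e i))

addVertex : ∀ {m} → SimpleGraph m → (Fin m → Bool) → SimpleGraph (suc m)
addVertex H p = record { adj = row ; sym = symmetric ; irrefl = loopless }
  where
  row : Fin _ → Fin _ → Bool
  row fz = false ∷ᶠ p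
  row (fs i) = p i ∷ᶠ adj H i
  symmetric : ∀ i j → row i j ≡ row j i
  symmetric fz fz = refl
  symmetric fz (fs j) = refl
  symmetric (fs i) fz = refl
  symmetric (fs i) (fs j) = SimpleGraph.sym H i j
  loopless : ∀ i → row i i ≡ false
  loopless fz = refl
  loopless (fs i) = irrefl H i

realizes-addVertex : ∀ {m} (H : SimpleGraph m) {deg} (p : Fin m → Bool) → Realizes H deg →
  Realizes (addVertex H p) (count p ∷ᶠ λ i → ind (p i) + deg i)
realizes-addVertex H p realizes fz = degree-count (addVertex H p) fz
realizes-addVertex H p realizes (fs i) =
  trans (degree-count (addVertex H p) (fs i))
        (cong (ind (p i) +_) (trans (sym (degree-count H i)) (realizes i)))

isPair : ∀ {n} → Fin n → Fin n → Fin n → Fin n → Bool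
isPair u v i j = (does (i ≟ u) ∧ does (j ≟ v)) ∨ (does (i ≟ v) ∧ does (j ≟ u))

isPair-sym : ∀ {n} (u v i j : Fin n) → isPair u v i j ≡ isPair u v j i
isPair-sym u v i j =
  trans (∨-comm (does (i ≟ u) ∧ does (j ≟ v)) _) (cong₂ _∨_ (∧-comm (does (i ≟ v)) _) (∧-comm (does (i ≟ u)) _))

isPair-swap : ∀ {n} (u v i j : Fin n) → isPair u v i j ≡ isPair v u i j
isPair-swap u v i j = ∨-comm (does (i ≟ u) ∧ does (j ≟ v)) _

isPair-end : ∀ {n} {u v : Fin n} → u ≢ v → ∀ j → isPair u v u j ≡ does (j ≟ v)
isPair-end {u = u} {v} u≢v j = begin
  (does (u ≟ u) ∧ does (j ≟ v)) ∨ (does (u ≟ v) ∧ does (j ≟ u))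
    ≡⟨ cong₂ (λ b c → (b ∧ does (j ≟ v)) ∨ (c ∧ does (j ≟ u)))
             (dec-true (u ≟ u) refl) (dec-false (u ≟ v) u≢v) ⟩
  does (j ≟ v) ∨ false
    ≡⟨ ∨-identityʳ _ ⟩
  does (j ≟ v) ∎

isPair-otherEnd : ∀ {n} {u v : Fin n} → u ≢ v → ∀ j → isPair u v v j ≡ does (j ≟ u)
isPair-otherEnd {u = u} {v} u≢v j = trans (isPair-swap u v v j) (isPair-end (u≢v ∘ sym) j)

isPair-outside : ∀ {n} {u v i : Fin n} → i ≢ u → i ≢ v → ∀ j → isPair u v i j ≡ false
isPair-outside {u = u} {v} {i} i≢u i≢v j =
  cong₂ (λ b c → (b ∧ does (j ≟ v)) ∨ (c ∧ does (j ≟ u))) (dec-false (i ≟ u) i≢u) (dec-false (i ≟ v) i≢v)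

not-both-ends : ∀ {n} {u v : Fin n} → u ≢ v → ∀ i → does (i ≟ u) ∧ does (i ≟ v) ≡ false
not-both-ends {u = u} {v} u≢v i with i ≟ u
... | no _ = refl
... | yes refl = dec-false (u ≟ v) u≢v

isPair-irrefl : ∀ {n} {u v : Fin n} → u ≢ v → ∀ i → isPair u v i i ≡ false
isPair-irrefl {u = u} {v} u≢v i = begin
  (does (i ≟ u) ∧ does (i ≟ v)) ∨ (does (i ≟ v) ∧ does (i ≟ u))
    ≡⟨ cong ((does (i ≟ u) ∧ does (i ≟ v)) ∨_) (∧-comm (does (i ≟ v)) _) ⟩
  (does (i ≟ u) ∧ does (i ≟ v)) ∨ (does (i ≟ u) ∧ does (i ≟ v))
    ≡⟨ ∨-idem _ ⟩
  does (i ≟ u) ∧ does (i ≟ v)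
    ≡⟨ not-both-ends u≢v i ⟩
  false ∎

addEdge : ∀ {n} (G : SimpleGraph n) (u v : Fin n) → u ≢ v → SimpleGraph n
addEdge G u v u≢v = record
  { adj = λ i j → isPair u v i j ∨ adj G i j
  ; sym = λ i j → cong₂ _∨_ (isPair-sym u v i j) (SimpleGraph.sym G i j)
  ; irrefl = λ i → cong₂ _∨_ (isPair-irrefl u≢v i) (irrefl G i) }

addEdge-keeps : ∀ {n} (G : SimpleGraph n) {u v} (u≢v : u ≢ v) {i j} →
  adj G i j ≡ true → adj (addEdge G u v u≢v) i j ≡ true
addEdge-keeps G {u} {v} _ {i} {j} e = trans (cong (isPair u v i j ∨_) e) (∨-zeroʳ _)

addEdge-adds : ∀ {n} (G : SimpleGraph n) {u v} (u≢v : u ≢ v) → adj (addEdge G u v u≢v) u v ≡ true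
addEdge-adds G {u} {v} u≢v = cong (_∨ adj G u v) (trans (isPair-end u≢v v) (dec-true (v ≟ v) refl))

degree-addEdge-end : ∀ {n} (G : SimpleGraph n) {u v} (u≢v : u ≢ v) → adj G u v ≡ false →
  degree (addEdge G u v u≢v) u ≡ suc (degree G u)
degree-addEdge-end G {u} {v} u≢v uv =
  trans (degree-row (addEdge G u v u≢v) (λ j → cong (_∨ adj G u j) (isPair-end u≢v j)))
        (trans (count-insert v (adj G u) uv) (cong suc (sym (degree-count G u))))

degree-addEdge-otherEnd : ∀ {n} (G : SimpleGraph n) {u v} (u≢v : u ≢ v) → adj G u v ≡ false →
  degree (addEdge G u v u≢v) v ≡ suc (degree G v)
degree-addEdge-otherEnd G {u} {v} u≢v uv =
  trans (degree-row (addEdge G u v u≢v) (λ j → cong (_∨ adj G v j) (isPair-otherEnd u≢v j)))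
        (trans (count-insert u (adj G v) (trans (SimpleGraph.sym G v u) uv)) (cong suc (sym (degree-count G v))))

degree-addEdge-outside : ∀ {n} (G : SimpleGraph n) {u v i} (u≢v : u ≢ v) → i ≢ u → i ≢ v →
  degree (addEdge G u v u≢v) i ≡ degree G i
degree-addEdge-outside G {u} {v} {i} u≢v i≢u i≢v =
  trans (degree-row (addEdge G u v u≢v) (λ j → cong (_∨ adj G i j) (isPair-outside i≢u i≢v j)))
        (sym (degree-count G i))

-- Lists of different (but equal) lengths index their vertices by different Fin types;
-- recording adjacency by the natural-number positions makes it transportable.

record AdjAt {n} (G : SimpleGraph n) (a b : ℕ) (v : Bool) : Set where
  constructor adjAt
  field at : ∀ i j → toℕ i ≡ a → toℕ j ≡ b → adj G i j ≡ v
open AdjAt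

adjAt-intro : ∀ {n} (G : SimpleGraph n) {i j v} → adj G i j ≡ v → AdjAt G (toℕ i) (toℕ j) v
adjAt-intro G {i} {j} e = adjAt λ i′ j′ i′≡i j′≡j →
  subst₂ (λ i″ j″ → adj G i″ j″ ≡ _) (sym (toℕ-injective i′≡i)) (sym (toℕ-injective j′≡j)) e

adjAt-sym : ∀ {n} {G : SimpleGraph n} {a b v} → AdjAt G a b v → AdjAt G b a v
adjAt-sym {G = G} e = adjAt λ i j i≡b j≡a → trans (SimpleGraph.sym G i j) (at e j i j≡a i≡b)

Fixes : ∀ {m n} → (Fin m → Fin n) → ℕ → Set
Fixes σ a = ∀ i → toℕ i ≡ a → toℕ (σ i) ≡ a

cast-fixes : ∀ {m n} (e : m ≡ n) a → Fixes (cast e) a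
cast-fixes e a i i≡a = trans (toℕ-cast e i) i≡a

relabel-adjAt : ∀ {m n} (H : SimpleGraph n) (σ : Fin m → Fin n) {a b v} →
  Fixes σ a → Fixes σ b → AdjAt H a b v → AdjAt (relabel H σ) a b v
relabel-adjAt H σ fixes-a fixes-b e = adjAt λ i j i≡a j≡b → at e (σ i) (σ j) (fixes-a i i≡a) (fixes-b j j≡b)

ShiftedBelow : ∀ {m n} → ℕ → SimpleGraph m → SimpleGraph n → Set
ShiftedBelow k H G = ∀ {a b v} → a < k → b < k → AdjAt H a b v → AdjAt G (suc a) (suc b) v

Star : ∀ {n} → SimpleGraph n → ℕ → ℕ → Set
Star G c k = (j : Fin k) → AdjAt G c (suc (c + toℕ j)) true

star-shift : ∀ {m n} {H : SimpleGraph m} {G : SimpleGraph n} {f c k} →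
  ShiftedBelow f H G → c + k < f → Star H c k → Star G (suc c) k
star-shift {c = c} {k} shifted c+k<f star j = shifted c<f c+j+1<f (star j)
  where
  c<f = ≤-<-trans (m≤m+n c k) c+k<f
  c+j+1<f = ≤-<-trans (+-monoʳ-< c (toℕ<n j)) c+k<f

record Realization (xs : List ℕ) : Set where
  constructor realization
  field
    graph    : SimpleGraph (length xs)
    realizes : Realizes graph (lookup xs)
open Realization using (graph)

record Reindexing (k : ℕ) (xs ys : List ℕ) : Set where
  field
    perm    : Permutation (length xs) (length ys)
    entries : ∀ i → lookup ys (perm ⟨$⟩ʳ i) ≡ lookup xs i
    fixes   : ∀ {a} → a < k → Fixes (perm ⟨$⟩ʳ_) a
open Reindexing

reindex-↭ : ∀ {xs ys} → xs ↭ ys → Reindexing 0 xs ys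
reindex-↭ p = record
  { perm = onIndices (↭⇒↭ₛ p)
  ; entries = λ i → sym (onIndices-lookup (↭⇒↭ₛ p) i)
  ; fixes = λ () }

reindex-∷ : ∀ {k xs ys} x → Reindexing k xs ys → Reindexing (suc k) (x ∷ xs) (x ∷ ys)
reindex-∷ {k} x ρ = record { perm = lift₀ (perm ρ) ; entries = entries′ ; fixes = fixes′ }
  where
  entries′ : ∀ i → _
  entries′ fz = refl
  entries′ (fs i) = entries ρ i
  fixes′ : ∀ {a} → a < suc k → Fixes (lift₀ (perm ρ) ⟨$⟩ʳ_) a
  fixes′ _ fz a≡0 = a≡0
  fixes′ {suc a} (s≤s a<k) (fs i) i≡a = cong suc (fixes ρ a<k i (suc-injective i≡a))

reindex-sortTail : ∀ f r → Reindexing f r (sortTail f r)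
reindex-sortTail zero r = reindex-↭ (↭-sym (sort-↭ r))
reindex-sortTail (suc f) [] = record { perm = perm ρ ; entries = entries ρ ; fixes = λ _ () }
  where ρ = reindex-↭ (↭-sym (sort-↭ []))
reindex-sortTail (suc f) (x ∷ r) = reindex-∷ x (reindex-sortTail f r)

realization-reindex : ∀ {k xs ys} → Reindexing k xs ys → (R : Realization ys) →
  Σ (Realization xs) λ R′ → ∀ {a b v} → a < k → b < k → AdjAt (graph R) a b v → AdjAt (graph R′) a b v
realization-reindex ρ (realization H realizes) =
  realization (relabel H (perm ρ ⟨$⟩ʳ_))
              (λ i → trans (degree-relabel H (perm ρ) i) (trans (realizes _) (entries ρ i))) ,
  λ a<k b<k → relabel-adjAt H (perm ρ ⟨$⟩ʳ_) (fixes ρ a<k) (fixes ρ b<k)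

decreased : ℕ → (xs : List ℕ) → Fin (length xs) → Bool
decreased zero xs _ = false
decreased (suc k) [] ()
decreased (suc k) (zero ∷ xs) = false ∷ᶠ decreased (suc k) xs
decreased (suc k) (suc x ∷ xs) = true ∷ᶠ decreased k xs

record LaidOff (x : ℕ) (xs r : List ℕ) (p : Fin (length xs) → Bool) : Set where
  field
    sameLength : length xs ≡ length r
    decrements : ∀ i → ind (p i) + lookup r (cast sameLength i) ≡ lookup xs i
    size       : count p ≡ x

laidOff-∷ : ∀ {k xs r p} b y → LaidOff k xs r p → LaidOff (ind b + k) (ind b + y ∷ xs) (y ∷ r) (b ∷ᶠ p)
laidOff-∷ b y L = record
  { sameLength = cong suc (sameLength L) ; decrements = decrements′ ; size = cong (ind b +_) (size L) }
  where
  open LaidOff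
  decrements′ : ∀ i → _
  decrements′ fz = refl
  decrements′ (fs i) = decrements L i

decNZ-laidOff : ∀ k xs {r} → decNZ k xs ≡ just r → LaidOff k xs r (decreased k xs)
decNZ-laidOff zero xs refl = record
  { sameLength = refl ; decrements = λ i → cong (lookup xs) (cast-is-id refl i) ; size = count-none (length xs) }
decNZ-laidOff (suc k) [] ()
decNZ-laidOff (suc k) (zero ∷ xs) eq with map-just (zero ∷_) (decNZ (suc k) xs) eq
... | _ , eq′ , refl = laidOff-∷ false zero (decNZ-laidOff (suc k) xs eq′)
decNZ-laidOff (suc k) (suc x ∷ xs) eq with map-just (x ∷_) (decNZ k xs) eq
... | _ , eq′ , refl = laidOff-∷ true x (decNZ-laidOff k xs eq′)

layOff-back : ∀ {x xs r p} → LaidOff x xs r p → (R : Realization r) →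
  Σ (Realization (x ∷ xs)) λ R′ →
    (∀ {a b v} → AdjAt (graph R) a b v → AdjAt (graph R′) (suc a) (suc b) v) ×
    (∀ j → adj (graph R′) fz (fs j) ≡ p j)
layOff-back {x} {xs} {r} {p} L (realization H realizes) = realization G realizesG , shifted , λ j → refl
  where
  open LaidOff L
  H′ = relabel H (cast sameLength)
  G = addVertex H′ p
  realizesG′ = realizes-addVertex H′ p (realizes-cast H sameLength realizes)
  realizesG : Realizes G (lookup (x ∷ xs))
  realizesG fz = trans (realizesG′ fz) size
  realizesG (fs i) = trans (realizesG′ (fs i)) (decrements i)
  shifted : ∀ {a b v} → AdjAt H a b v → AdjAt G (suc a) (suc b) v
  shifted {a} {b} e = adjAt λ
    { (fs i) (fs j) i≡a j≡b →
        at (relabel-adjAt H (cast sameLength) (cast-fixes sameLength a) (cast-fixes sameLength b) e)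
           i j (suc-injective i≡a) (suc-injective j≡b)
    ; fz _ () _
    ; (fs _) fz _ () }

-- Undoing step i on a list x ∷ xs (i ≠ 6): adjacency among the first 7 ∸ i positions
-- survives (the reordering only moves later terms), and vertex 0 is joined to the decreased terms.
step-back : ∀ i x xs {q} → step i (x ∷ xs) ≡ just q → (R : Realization q) →
  Σ (Realization (x ∷ xs)) λ R′ →
    ShiftedBelow (7 ∸ i) (graph R) (graph R′) × (∀ j → adj (graph R′) fz (fs j) ≡ decreased x xs j)
step-back i x xs eq R with map-just (sortTail (7 ∸ i)) (decNZ x xs) eq
... | r , laid , refl =
  let (R₁ , keeps) = realization-reindex (reindex-sortTail (7 ∸ i) r) R
      (R′ , shifted , joins) = layOff-back (decNZ-laidOff x xs laid) R₁
  in R′ , (λ a<k b<k e → shifted (keeps a<k b<k e)) , joins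

step-back-list : ∀ i p {q} → step i p ≡ just q → (R : Realization q) →
  Σ (Realization p) λ R′ → ShiftedBelow (7 ∸ i) (graph R) (graph R′)
step-back-list i [] ()
step-back-list i (x ∷ xs) eq R = let (R′ , shifted , _) = step-back i x xs eq R in R′ , shifted

-- Step 6 leaves its second term alone, so the first two vertices are not adjacent.
step6-back : ∀ p {q} → step6 p ≡ just q → Realization q →
  Σ (Realization p) λ R′ → AdjAt (graph R′) 0 1 false
step6-back [] ()
step6-back (x ∷ []) ()
step6-back (x ∷ y ∷ xs) eq R with map-just (λ r → y ∷ sort r) (decNZ x xs) eq
... | r , laid , refl =
  let (R₁ , _) = realization-reindex (reindex-∷ y (reindex-↭ (↭-sym (sort-↭ r)))) R
      (R′ , _ , joins) = layOff-back (laidOff-∷ false y (decNZ-laidOff x xs laid)) R₁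
  in R′ , adjAt-intro (graph R′) (joins fz)

LeadingPositive : ℕ → List ℕ → Set
LeadingPositive zero _ = ⊤
LeadingPositive (suc m) (suc x ∷ xs) = LeadingPositive m xs
LeadingPositive (suc m) _ = ⊥

decreased-leading : ∀ {m k} xs → m ≤ k → LeadingPositive m xs → ∀ j → toℕ j < m → decreased k xs j ≡ true
decreased-leading {suc m} {suc k} (suc x ∷ xs) _ _ fz _ = refl
decreased-leading {suc m} {suc k} (suc x ∷ xs) (s≤s m≤k) lead (fs j) (s≤s j<m) = decreased-leading xs m≤k lead j j<m

star-joins : ∀ {x xs m} (R : Realization (x ∷ xs)) → (∀ j → adj (graph R) fz (fs j) ≡ decreased x xs j) →
  m ≤ x → LeadingPositive m xs → Star (graph R) 0 m
star-joins {xs = xs} {m} R joins m≤x lead j = adjAt λ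
  { fz (fs i) _ i≡j →
      trans (joins i) (decreased-leading xs m≤x lead i (subst (_< m) (sym (suc-injective i≡j)) (toℕ<n j)))
  ; fz fz _ ()
  ; (fs _) _ () _ }

data Front : List ℕ → Set where
  excesses : ∀ a b c d e f g T → Front (6 + a ∷ 6 + b ∷ 5 + c ∷ 4 + d ∷ 4 + e ∷ 4 + f ∷ 3 + g ∷ T)

front-from-bounds : ∀ {a b c d e f g T} → 6 ≤ a → 6 ≤ b → 5 ≤ c → 4 ≤ d → 4 ≤ e → 4 ≤ f → 3 ≤ g →
  Front (a ∷ b ∷ c ∷ d ∷ e ∷ f ∷ g ∷ T)
front-from-bounds {T = T} ha hb hc hd he hf hg
  with m≤n⇒∃[o]m+o≡n ha | m≤n⇒∃[o]m+o≡n hb | m≤n⇒∃[o]m+o≡n hc | m≤n⇒∃[o]m+o≡n hd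
     | m≤n⇒∃[o]m+o≡n he | m≤n⇒∃[o]m+o≡n hf | m≤n⇒∃[o]m+o≡n hg
... | a , refl | b , refl | c , refl | d , refl | e , refl | f , refl | g , refl = excesses a b c d e f g T

record Run (xs s : List ℕ) : Set where
  constructor run
  field
    π₁ π₂ π₃ π₄ π₅ π₆ : List ℕ
    step₁ : step 1 (π₀ xs) ≡ just π₁
    step₂ : step 2 π₁ ≡ just π₂
    step₃ : step 3 π₂ ≡ just π₃
    step₄ : step 4 π₃ ≡ just π₄
    step₅ : step 5 π₄ ≡ just π₅
    step₆ : step6 π₅ ≡ just π₆
    step₇ : step 7 π₆ ≡ just s

run-of : ∀ xs {s} → π₇ xs ≡ just s → Run xs s
run-of xs eq with bind-just (step 7) eq
... | p₆ , eq₆ , st₇ with bind-just step6 eq₆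
... | p₅ , eq₅ , st₆ with bind-just (step 5) eq₅
... | p₄ , eq₄ , st₅ with bind-just (step 4) eq₄
... | p₃ , eq₃ , st₄ with bind-just (step 3) eq₃
... | p₂ , eq₂ , st₃ with bind-just (step 2) eq₂
... | p₁ , st₁ , st₂ = run p₁ p₂ p₃ p₄ p₅ p₆ st₁ st₂ st₃ st₄ st₅ st₆ st₇

-- Steps 1–3 act on leading terms that are known to be positive.
shape₁ : ∀ a b c d e f g T {p} → step 1 (π₀ (6 + a ∷ 6 + b ∷ 5 + c ∷ 4 + d ∷ 4 + e ∷ 4 + f ∷ 3 + g ∷ T)) ≡ just p →
  ∃ λ r → p ≡ 5 + b ∷ 4 + c ∷ 3 + d ∷ 3 + e ∷ 2 + f ∷ 1 + g ∷ sort r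
shape₁ a b c d e f g T eq with decNZ a T | eq
... | just r | refl = r , refl
... | nothing | ()

shape₂ : ∀ b c d e f g r {p} → step 2 (5 + b ∷ 4 + c ∷ 3 + d ∷ 3 + e ∷ 2 + f ∷ 1 + g ∷ sort r) ≡ just p →
  ∃ λ r′ → p ≡ 3 + c ∷ 2 + d ∷ 2 + e ∷ 1 + f ∷ g ∷ sort r′
shape₂ b c d e f g r eq with decNZ b (sort r) | eq
... | just r′ | refl = r′ , refl
... | nothing | ()

shape₃ : ∀ c d e f g r {p} → step 3 (3 + c ∷ 2 + d ∷ 2 + e ∷ 1 + f ∷ g ∷ sort r) ≡ just p →
  ∃ λ r′ → p ≡ 1 + d ∷ 1 + e ∷ f ∷ sortTail 1 r′
shape₃ c d e f g r eq with decNZ c (g ∷ sort r) | eq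
... | just r′ | refl = r′ , refl
... | nothing | ()

-- The configuration found in the realization of π₀: stars at positions 0–3 covering the
-- edges of G(7) other than x₁x₂, and the non-edge between positions 5 and 6.
record Stars {n} (G : SimpleGraph n) : Set where
  field
    star₀ : Star G 0 6
    star₁ : Star G 1 5
    star₂ : Star G 2 3
    star₃ : Star G 3 1
    gap   : AdjAt G 5 6 false

-- Undoing steps 7, …, 1: the stars come from steps 1–4 (the leading terms are positive
-- and laid off) and are carried forward through the earlier undone steps; the gap from step 6.
undo-run : ∀ a b c d e f g T {s} →
  Run (6 + a ∷ 6 + b ∷ 5 + c ∷ 4 + d ∷ 4 + e ∷ 4 + f ∷ 3 + g ∷ T) s → Realization s →
  Σ (Realization (6 + a ∷ 6 + b ∷ 5 + c ∷ 4 + d ∷ 4 + e ∷ 3 + f ∷ 2 + g ∷ T)) (Stars ∘ graph)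
undo-run a b c d e f g T (run _ _ _ p₄ p₅ p₆ st₁ st₂ st₃ st₄ st₅ st₆ st₇) Rs
  with shape₁ a b c d e f g T st₁
... | r₁ , refl with shape₂ b c d e f g r₁ st₂
... | r₂ , refl with shape₃ c d e f g r₂ st₃
... | r₃ , refl =
  let (R₆ , _) = step-back-list 7 p₆ st₇ Rs
      (R₅ , gap₅) = step6-back p₅ st₆ R₆
      (R₄ , sh₅) = step-back-list 5 p₄ st₅ R₅
      (R₃ , sh₄ , joins₄) = step-back 4 _ _ st₄ R₄
      (R₂ , sh₃ , joins₃) = step-back 3 _ _ st₃ R₃
      (R₁ , sh₂ , joins₂) = step-back 2 _ _ st₂ R₂
      (R₀ , sh₁ , joins₁) = step-back 1 _ _ st₁ R₁
      lit = ≤-numerals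
  in R₀ , record
    { star₀ = star-joins R₀ joins₁ (m≤m+n 6 a) _
    ; star₁ = star-shift sh₁ lit (star-joins R₁ joins₂ (m≤m+n 5 b) _)
    ; star₂ = star-shift sh₁ lit (star-shift sh₂ lit (star-joins R₂ joins₃ (m≤m+n 3 c) _))
    ; star₃ = star-shift sh₁ lit (star-shift sh₂ lit (star-shift sh₃ lit (star-joins R₃ joins₄ (m≤m+n 1 d) _)))
    ; gap = sh₁ lit lit (sh₂ lit lit (sh₃ lit lit (sh₄ lit lit (sh₅ lit lit gap₅)))) }

layout : Fin 7 → Fin 7
layout a with toℕ a
... | 4 = # 6
... | 6 = # 4
... | _ = a

layout-involutive : ∀ a → layout (layout a) ≡ a
layout-involutive fz = refl
layout-involutive (fs fz) = refl
layout-involutive (fs (fs fz)) = refl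
layout-involutive (fs (fs (fs fz))) = refl
layout-involutive (fs (fs (fs (fs fz)))) = refl
layout-involutive (fs (fs (fs (fs (fs fz))))) = refl
layout-involutive (fs (fs (fs (fs (fs (fs fz)))))) = refl

G7AtFront : ∀ {n} → SimpleGraph n → Set
G7AtFront G = All (λ { (a , b) → AdjAt G (toℕ (layout a)) (toℕ (layout b)) true }) G7-edges

g7AtFront : ∀ {m n} {H : SimpleGraph m} {G : SimpleGraph n} → Stars H →
  (∀ {a b} → AdjAt H a b true → AdjAt G a b true) → AdjAt G 5 6 true → G7AtFront G
g7AtFront stars keep e₅₆ =
  keep (star₀ (# 0)) ∷ keep (star₀ (# 1)) ∷ keep (star₀ (# 2)) ∷
  keep (star₁ (# 0)) ∷ keep (star₁ (# 1)) ∷ keep (star₂ (# 0)) ∷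
  back (star₀ (# 5)) ∷ back (star₁ (# 4)) ∷
  back (star₀ (# 4)) ∷ back (star₁ (# 3)) ∷ back (star₂ (# 2)) ∷
  back (star₀ (# 3)) ∷ back (star₁ (# 2)) ∷ back (star₂ (# 1)) ∷ back (star₃ (# 0)) ∷
  adjAt-sym e₅₆ ∷ []
  where
  open Stars stars
  back = λ {a b} (e : AdjAt _ a b true) → adjAt-sym (keep e)

containsG7 : ∀ {n} {G : SimpleGraph n} → 7 ≤ n → G7AtFront G → ContainsG7 G
containsG7 {G = G} 7≤n atFront = embed , embed-injective , mapAll (λ { {a , b} → edge a b }) atFront
  where
  embed : Fin 7 → Fin _
  embed a = inject≤ (layout a) 7≤n
  embed-injective : Injective _≡_ _≡_ embed
  embed-injective {a} {b} e = begin
    a                 ≡⟨ sym (layout-involutive a) ⟩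
    layout (layout a) ≡⟨ cong layout (inject≤-injective 7≤n 7≤n _ _ e) ⟩
    layout (layout b) ≡⟨ layout-involutive b ⟩
    b                 ∎
  edge : ∀ a b → AdjAt G (toℕ (layout a)) (toℕ (layout b)) true → adj G (embed a) (embed b) ≡ true
  edge a b e = at e (embed a) (embed b) (toℕ-inject≤ (layout a) 7≤n) (toℕ-inject≤ (layout b) 7≤n)

-- Undoing π₀: the positions 5 and 6 lost one degree each through the missing edge.
undo-π₀ : ∀ a b c d e f g T (R : Realization (a ∷ b ∷ c ∷ d ∷ e ∷ f ∷ g ∷ T)) → AdjAt (graph R) 5 6 false →
  Σ (Realization (a ∷ b ∷ c ∷ d ∷ e ∷ suc f ∷ suc g ∷ T)) λ R′ →
    (∀ {x y} → AdjAt (graph R) x y true → AdjAt (graph R′) x y true) × AdjAt (graph R′) 5 6 true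
undo-π₀ a b c d e f g T (realization G realizes) gap =
  realization G′ realizes′ , keep , adjAt-intro G′ (addEdge-adds G u≢v)
  where
  u v : Fin (7 + length T)
  u = # 5
  v = # 6
  u≢v : u ≢ v
  u≢v ()
  uv : adj G u v ≡ false
  uv = at gap u v refl refl
  G′ = addEdge G u v u≢v
  unchanged : ∀ i → i ≢ u → i ≢ v → degree G′ i ≡ lookup (a ∷ b ∷ c ∷ d ∷ e ∷ f ∷ g ∷ T) i
  unchanged i i≢u i≢v = trans (degree-addEdge-outside G u≢v i≢u i≢v) (realizes i)
  realizes′ : Realizes G′ (lookup (a ∷ b ∷ c ∷ d ∷ e ∷ suc f ∷ suc g ∷ T))
  realizes′ fz = unchanged fz (λ ()) (λ ())
  realizes′ i@(fs fz) = unchanged i (λ ()) (λ ())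
  realizes′ i@(fs (fs fz)) = unchanged i (λ ()) (λ ())
  realizes′ i@(fs (fs (fs fz))) = unchanged i (λ ()) (λ ())
  realizes′ i@(fs (fs (fs (fs fz)))) = unchanged i (λ ()) (λ ())
  realizes′ (fs (fs (fs (fs (fs fz))))) = trans (degree-addEdge-end G u≢v uv) (cong suc (realizes u))
  realizes′ (fs (fs (fs (fs (fs (fs fz)))))) = trans (degree-addEdge-otherEnd G u≢v uv) (cong suc (realizes v))
  realizes′ i@(fs (fs (fs (fs (fs (fs (fs _))))))) = unchanged i (λ ()) (λ ())
  keep : ∀ {x y} → AdjAt G x y true → AdjAt G′ x y true
  keep e = adjAt λ i j i≡x j≡y → addEdge-keeps G u≢v (at e i j i≡x j≡y)

front-G7 : ∀ {xs s} → Front xs → π₇ xs ≡ just s → Realization s → Σ (Realization xs) (G7AtFront ∘ graph)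
front-G7 (excesses a b c d e f g T) eq Rs =
  let (R₀ , stars) = undo-run a b c d e f g T (run-of _ eq) Rs
      (R , keep , e₅₆) = undo-π₀ _ _ _ _ _ (3 + f) (2 + g) T R₀ (Stars.gap stars)
  in R , g7AtFront stars keep e₅₆

lookup-toList : ∀ {n} (d : Vec ℕ n) .(e : n ≡ length (toList d)) i → lookup (toList d) (cast e i) ≡ lookupᵛ d i
lookup-toList (x ∷ᵛ d) e fz = refl
lookup-toList (x ∷ᵛ d) e (fs i) = lookup-toList d (suc-injective e) i

lookup-fromList : ∀ (s : List ℕ) i → lookupᵛ (fromList s) i ≡ lookup s i
lookup-fromList (x ∷ s) fz = refl
lookup-fromList (x ∷ s) (fs i) = lookup-fromList s i

realization-toList : ∀ {n} (d : Vec ℕ n) (R : Realization (toList d)) →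
  Σ (SimpleGraph n) λ G → IsRealization d G × (∀ {a b} → AdjAt (graph R) a b true → AdjAt G a b true)
realization-toList d (realization H realizes) =
  relabel H (cast e) ,
  (λ i → trans (realizes-cast H e realizes i) (lookup-toList d e i)) ,
  relabel-adjAt H (cast e) (cast-fixes e _) (cast-fixes e _)
  where
  e = sym (length-toList d)

entry-last : ∀ {m} (d : Vec ℕ (suc m)) → entry d (suc m) ≡ lookupᵛ d (fromℕ m)
entry-last (x ∷ᵛ []ᵛ) = refl
entry-last (x ∷ᵛ y ∷ᵛ d) = entry-last (y ∷ᵛ d)

front-of : ∀ {n} → 7 ≤ n → (d : Vec ℕ n) → NonIncreasing d →
  6 ≤ entry d 2 → 5 ≤ entry d 3 → 4 ≤ entry d 6 → 3 ≤ entry d n → Front (toList d)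
front-of 7≤n d decreasing d₂ d₃ d₆ dₙ with m≤n⇒∃[o]m+o≡n 7≤n
front-of _ (a ∷ᵛ b ∷ᵛ c ∷ᵛ d ∷ᵛ e ∷ᵛ f ∷ᵛ g ∷ᵛ T) decreasing d₂ d₃ d₆ dₙ | o , refl =
  front-from-bounds (≤-trans d₂ (decreasing (# 0) (# 1) ≤-numerals)) d₂ d₃
        (≤-trans d₆ (decreasing (# 3) (# 5) ≤-numerals)) (≤-trans d₆ (decreasing (# 4) (# 5) ≤-numerals)) d₆
        (≤-trans (subst (3 ≤_) (entry-last (g ∷ᵛ T)) dₙ)
                 (decreasing (# 6) (fs (fs (fs (fs (fs (fs (fromℕ o))))))) (m≤m+n 6 _)))

proposition3p1 : (n : ℕ) → 30 ≤ n → (d : Vec ℕ n) → Graphic d →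
    6 ≤ entry d 2 → 5 ≤ entry d 3 → 4 ≤ entry d 6 → 3 ≤ entry d n →
    (s : List ℕ) → π₇ (toList d) ≡ just s → Graphic (fromList s) →
    Σ (SimpleGraph n) (λ G → IsRealization d G × ContainsG7 G)
proposition3p1 n 30≤n d (decreasing , _) d₂ d₃ d₆ dₙ s π₇≡s (_ , H , H-realizes) =
  let 7≤n = ≤-trans ≤-numerals 30≤n
      Rs = realization H λ i → trans (H-realizes i) (lookup-fromList s i)
      (R , atFront) = front-G7 (front-of 7≤n d decreasing d₂ d₃ d₆ dₙ) π₇≡s Rs
      (G , G-realizes , keep) = realization-toList d R
  in G , G-realizes , containsG7 7≤n (mapAll (λ { {_ , _} → keep }) atFront)
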